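{- Let $n,k,\ell,\alpha,\beta,\gamma$ be non-negative integers such that $\alpha\mid\gamma$, $\alpha\mid\beta$, $k\le n$, $\ell\le n$. Then $$S^{\gamma,\alpha,\beta}_{n+1,k,\ell}=\sum_{i=0}^{n}\sum_{j=0}^{k}\binom{n}{i}\left[\left\{ {i+1 \atop j} \right\}^{>\ell}_{\gamma}\left\{ {n-i \atop k-j} \right\}^{\le\ell}_{\alpha,\beta}+\left\{ {i \atop j} \right\}^{>\ell}_{\gamma}\left\{ {n-i+1 \atop k-j} \right\}^{\le\ell}_{\alpha,\beta}\right].$$
   Context: Degenerate falling factorial: $(t)_{m,\lambda}=t(t-\lambda)\cdots(t-(m-1)\lambda)$, $(t)_{0,\lambda}=1$. All the following numbers are defined as weighted sums over pairs $(G,P)$ where $G$ is a possibly empty subset of the ground set $\{1,\dots,m\}$ and $P$ is a set partition of the complement of $G$ into a prescribed number of non-empty blocks; $0^0=1$. (1) $\left\{ {m \atop j} \right\}^{>\ell}_{\gamma}$: $P$ has $j$ blocks, each with more than $\ell$ elements; weight $\gamma^{|G|}$. (2) $\left\{ {m \atop j} \right\}^{\le\ell}_{\alpha,\beta}$: $G=\emptyset$, $P$ has $j$ blocks each with at most $\ell$ elements; weight $\prod_{B\in P}(\beta-\alpha)_{|B|-1,\alpha}$. (3) $S^{\gamma,\alpha,\beta}_{m,k,\ell}$ (number of $\ell$-restricted $(\alpha,\beta,\gamma)$-partial degenerate partitions): $P$ has $k$ blocks of arbitrary sizes; weight $\gamma^{|G|}\prod_{B\in P}w(B)$ where $w(B)=(\beta-\alpha)_{|B|-1,\alpha}$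 if $|B|\le\ell$ and $w(B)=1$ if $|B|>\ell$. -}

module Defs where

open import Data.Bool using (Bool; true; false; if_then_else_; _∧_)
open import Data.Nat using (ℕ; zero; suc; _≡ᵇ_; _<ᵇ_; _∸_)
open import Data.Nat.Combinatorics using (_C_)
open import Data.Integer using (ℤ; +_; _-_; _*_; _^_)
open import Data.Maybe using (Maybe; nothing; just)
open import Data.List using (List; []; _∷_; [_]; map; concatMap; filter; upTo; foldr; length)
import Data.Integer as ℤ
open import Relation.Nullary.Decidable using (yes; no)
open import Data.Bool using (T?)

degFall : ℤ → ℕ → ℤ → ℤ
degFall t zero    l = + 1
degFall t (suc m) l = degFall t m l * (t - (+ m) * l)

sumℤ : List ℤ → ℤ
sumℤ = foldr ℤ._+_ (+ 0)

prodℤ : List ℤ → ℤ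
prodℤ = foldr _*_ (+ 1)

sumTo : ℕ → (ℕ → ℤ) → ℤ
sumTo n f = sumℤ (map f (upTo (suc n)))

-- A "word" of length m assigns to each element 1..m (in order) either
-- `nothing` (the element lies in G) or `just b` (the element lies in the
-- block with label b, 0 ≤ b < j).  Set partitions of the complement of G
-- into exactly j non-empty blocks correspond bijectively to words in
-- restricted-growth form: blocks are labelled 0,1,…,j-1 in order of their
-- least element.  `rgs j c w` checks this (c = number of blocks opened so
-- far) and that exactly j blocks are opened.

words : {A : Set} → List A → ℕ → List (List A)
words xs zero    = [ [] ]
words xs (suc m) = concatMap (λ w → map (λ x → x ∷ w) xs) (words xs m)

labels : ℕ → List (Maybe ℕ)
labels j = nothing ∷ map just (upTo j)

rgs : ℕ → ℕ → List (Maybe ℕ) → Bool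
rgs j c []             = c ≡ᵇ j
rgs j c (nothing ∷ w)  = rgs j c w
rgs j c (just b ∷ w)   =
  if b <ᵇ c then rgs j c w
  else (if b ≡ᵇ c then rgs j (suc c) w else false)

pairs : ℕ → ℕ → List (List (Maybe ℕ))
pairs m j = filter (λ w → T? (rgs j 0 w)) (words (labels j) m)

count : (Maybe ℕ → Bool) → List (Maybe ℕ) → ℕ
count p []      = 0
count p (x ∷ w) = if p x then suc (count p w) else count p w

isNothing : Maybe ℕ → Bool
isNothing nothing  = true
isNothing (just _) = false

isLabel : ℕ → Maybe ℕ → Bool
isLabel b nothing  = false
isLabel b (just c) = b ≡ᵇ c

sizeG : List (Maybe ℕ) → ℕ
sizeG = count isNothing

blockSizes : ℕ → List (Maybe ℕ) → List ℕ
blockSizes j w = map (λ b → count (isLabel b) w) (upTo j)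

allB : (ℕ → Bool) → List ℕ → Bool
allB p = foldr (λ x r → p x ∧ r) true

pairSum : ℕ → ℕ → (List (Maybe ℕ) → Bool) → (List (Maybe ℕ) → ℤ) → ℤ
pairSum m j admissible weight =
  sumℤ (map weight (filter (λ w → T? (admissible w)) (pairs m j)))

blockProd : ℕ → (ℕ → ℤ) → List (Maybe ℕ) → ℤ
blockProd j f w = prodℤ (map f (blockSizes j w))

S>ℓ : ℕ → ℕ → ℕ → ℕ → ℤ
S>ℓ ℓ γ m j =
  pairSum m j (λ w → allB (λ s → ℓ <ᵇ s) (blockSizes j w))
              (λ w → (+ γ) ^ sizeG w)

S≤ℓ : ℕ → ℕ → ℕ → ℕ → ℕ → ℤ
S≤ℓ ℓ α β m j =
  pairSum m j (λ w → (sizeG w ≡ᵇ 0) ∧ allB (λ s → s <ᵇ suc ℓ) (blockSizes j w))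
              (blockProd j (λ s → degFall ((+ β) - (+ α)) (s ∸ 1) (+ α)))

wBlock : ℕ → ℕ → ℕ → ℕ → ℤ
wBlock ℓ α β s =
  if s <ᵇ suc ℓ then degFall ((+ β) - (+ α)) (s ∸ 1) (+ α) else + 1

Spart : ℕ → ℕ → ℕ → ℕ → ℕ → ℕ → ℤ
Spart γ α β m k ℓ =
  pairSum m k (λ _ → true)
              (λ w → ((+ γ) ^ sizeG w) * blockProd k (wBlock ℓ α β) w)

module Submission where

-- Write F_{g,f}(m,k) for the sum, over pairs (G,P) on {1,…,m} with P a partition into k blocks,
-- of g^|G| ∏_{B∈P} f(|B|). Classifying by where the first element goes (into G, or into a block
-- together with a of the other elements) gives
--   F(m+1,k) = g F(m,k) + ∑_a C(m,a) f(a+1) F(m−a,k−1),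
-- which with F(0,k) = [k = 0] determines F. The binomial convolution
-- ∑_i C(m,i) ∑_j F₁(i,j) F₂(m−i,k−j) of solutions for (g₁,f₁) and (g₂,f₂) solves the recurrence
-- for (g₁+g₂, f₁+f₂), i.e. exponential generating functions multiply. Now S^{γ,α,β} = F_{γ,w},
-- S^{>ℓ}_γ = F_{γ,[s>ℓ]} and S^{≤ℓ}_{α,β} = F_{0,v} with v(s) = [s≤ℓ](β−α)_{s−1,α} (the factor
-- 0^|G| forces G = ∅), and w = [s>ℓ] + v; so S is the convolution of the other two, and Pascal's
-- rule for C(n+1,i) gives the stated form.

open import Data.Bool using (Bool; true; false; if_then_else_; _∧_; not; T?)
open import Data.List using (List; []; _∷_; map; concatMap; filter; upTo; applyUpTo; _++_)
open import Data.List.Properties using (map-applyUpTo; map-upTo; map-cong)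
open import Data.Maybe using (Maybe; nothing; just)
open import Data.Nat using (ℕ; zero; suc; _≤_; _<_; _∸_; z≤n; s≤s; _<ᵇ_; _≡ᵇ_)
import Data.Nat.Properties as ℕ
open import Data.Nat.Combinatorics using (_C_; nCk+nC[k+1]≡[n+1]C[k+1]; k>n⇒nCk≡0)
open import Data.Nat.Divisibility using (_∣_)
open import Data.Nat.Induction using (<-rec)
open import Data.Integer using (ℤ; +_; _+_; _-_; _*_; _^_)
import Data.Integer.Properties as ℤ
import Algebra.Properties.CommutativeSemigroup ℤ.+-commutativeSemigroup as +-Comm
import Algebra.Properties.CommutativeSemigroup ℤ.*-commutativeSemigroup as *-Comm
open import Data.Integer.Tactic.RingSolver using (solve-∀)
open import Data.Product using (_×_; _,_)
open import Function using (_∘_; flip)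
open import Relation.Binary.PropositionalEquality
open ≡-Reasoning

open import Defs

∑< : ℕ → (ℕ → ℤ) → ℤ
∑< zero    f = + 0
∑< (suc n) f = f 0 + ∑< n (f ∘ suc)

∑<-cong : ∀ n {f g : ℕ → ℤ} → (∀ i → f i ≡ g i) → ∑< n f ≡ ∑< n g
∑<-cong zero    f≗g = refl
∑<-cong (suc n) f≗g = cong₂ _+_ (f≗g 0) (∑<-cong n (f≗g ∘ suc))

∑<-cong-< : ∀ n {f g : ℕ → ℤ} → (∀ i → i < n → f i ≡ g i) → ∑< n f ≡ ∑< n g
∑<-cong-< zero    f≗g = refl
∑<-cong-< (suc n) f≗g = cong₂ _+_ (f≗g 0 (s≤s z≤n)) (∑<-cong-< n (λ i i<n → f≗g (suc i) (s≤s i<n)))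

∑<-zero : ∀ n → ∑< n (λ _ → + 0) ≡ + 0
∑<-zero zero    = refl
∑<-zero (suc n) = trans (ℤ.+-identityˡ _) (∑<-zero n)

∑<-+ : ∀ n (f g : ℕ → ℤ) → ∑< n (λ i → f i + g i) ≡ ∑< n f + ∑< n g
∑<-+ zero    f g = refl
∑<-+ (suc n) f g = begin
  (f 0 + g 0) + ∑< n (λ i → f (suc i) + g (suc i)) ≡⟨ cong (_+_ (f 0 + g 0)) (∑<-+ n (f ∘ suc) (g ∘ suc)) ⟩
  (f 0 + g 0) + (∑< n (f ∘ suc) + ∑< n (g ∘ suc))  ≡⟨ +-Comm.interchange (f 0) (g 0) _ _ ⟩
  (f 0 + ∑< n (f ∘ suc)) + (g 0 + ∑< n (g ∘ suc))  ∎

∑<-*ˡ : ∀ n c (f : ℕ → ℤ) → ∑< n (λ i → c * f i) ≡ c * ∑< n f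
∑<-*ˡ zero    c f = sym (ℤ.*-zeroʳ c)
∑<-*ˡ (suc n) c f = trans (cong (_+_ (c * f 0)) (∑<-*ˡ n c (f ∘ suc))) (sym (ℤ.*-distribˡ-+ c (f 0) _))

∑<-last : ∀ n (f : ℕ → ℤ) → ∑< (suc n) f ≡ ∑< n f + f n
∑<-last zero    f = ℤ.+-comm (f 0) (+ 0)
∑<-last (suc n) f = trans (cong (_+_ (f 0)) (∑<-last n (f ∘ suc))) (sym (ℤ.+-assoc (f 0) _ _))

∑<-comm : ∀ n m (F : ℕ → ℕ → ℤ) → ∑< n (λ i → ∑< m (F i)) ≡ ∑< m (λ j → ∑< n (λ i → F i j))
∑<-comm zero    m F = sym (∑<-zero m)
∑<-comm (suc n) m F = trans (cong (_+_ (∑< m (F 0))) (∑<-comm n m (F ∘ suc)))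
  (sym (∑<-+ m (F 0) (λ j → ∑< n (λ i → F (suc i) j))))

sumOver : {A : Set} → List A → (A → ℤ) → ℤ
sumOver xs h = sumℤ (map h xs)

module _ {A : Set} where

  sumOver-cong : ∀ (xs : List A) {f g : A → ℤ} → (∀ x → f x ≡ g x) → sumOver xs f ≡ sumOver xs g
  sumOver-cong []       f≗g = refl
  sumOver-cong (x ∷ xs) f≗g = cong₂ _+_ (f≗g x) (sumOver-cong xs f≗g)

  sumOver-zero : ∀ (xs : List A) → sumOver xs (λ _ → + 0) ≡ + 0
  sumOver-zero []       = refl
  sumOver-zero (x ∷ xs) = trans (ℤ.+-identityˡ _) (sumOver-zero xs)

  sumOver-+ : ∀ (xs : List A) (f g : A → ℤ) → sumOver xs (λ x → f x + g x) ≡ sumOver xs f + sumOver xs g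
  sumOver-+ []       f g = refl
  sumOver-+ (x ∷ xs) f g = trans (cong (_+_ (f x + g x)) (sumOver-+ xs f g)) (+-Comm.interchange (f x) (g x) _ _)

  sumOver-++ : ∀ (xs ys : List A) (h : A → ℤ) → sumOver (xs ++ ys) h ≡ sumOver xs h + sumOver ys h
  sumOver-++ []       ys h = sym (ℤ.+-identityˡ _)
  sumOver-++ (x ∷ xs) ys h = trans (cong (_+_ (h x)) (sumOver-++ xs ys h)) (sym (ℤ.+-assoc (h x) _ _))

  sumOver-applyUpTo : ∀ n (φ : ℕ → A) (h : A → ℤ) → sumOver (applyUpTo φ n) h ≡ ∑< n (h ∘ φ)
  sumOver-applyUpTo zero    φ h = refl
  sumOver-applyUpTo (suc n) φ h = cong (_+_ (h (φ 0))) (sumOver-applyUpTo n (φ ∘ suc) h)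

  sumOver-filter : ∀ (p : A → Bool) (h : A → ℤ) (xs : List A) →
    sumOver (filter (λ x → T? (p x)) xs) h ≡ sumOver xs (λ x → if p x then h x else + 0)
  sumOver-filter p h []       = refl
  sumOver-filter p h (x ∷ xs) with p x
  ... | true  = cong (_+_ (h x)) (sumOver-filter p h xs)
  ... | false = trans (sumOver-filter p h xs) (sym (ℤ.+-identityˡ _))

module _ {A B : Set} where

  sumOver-map : ∀ (xs : List A) (g : A → B) (h : B → ℤ) → sumOver (map g xs) h ≡ sumOver xs (h ∘ g)
  sumOver-map []       g h = refl
  sumOver-map (x ∷ xs) g h = cong (_+_ (h (g x))) (sumOver-map xs g h)

  sumOver-concatMap : ∀ (xs : List A) (g : A → List B) (h : B → ℤ) →
    sumOver (concatMap g xs) h ≡ sumOver xs (λ x → sumOver (g x) h)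
  sumOver-concatMap []       g h = refl
  sumOver-concatMap (x ∷ xs) g h =
    trans (sumOver-++ (g x) (concatMap g xs) h) (cong (_+_ (sumOver (g x) h)) (sumOver-concatMap xs g h))

  sumOver-comm : ∀ (xs : List A) (ys : List B) (F : A → B → ℤ) →
    sumOver xs (λ x → sumOver ys (F x)) ≡ sumOver ys (λ y → sumOver xs (λ x → F x y))
  sumOver-comm []       ys F = sym (sumOver-zero ys)
  sumOver-comm (x ∷ xs) ys F =
    trans (cong (_+_ (sumOver ys (F x))) (sumOver-comm xs ys F)) (sym (sumOver-+ ys (F x) (λ y → sumOver xs (λ x → F x y))))

sumTo≡∑< : ∀ n f → sumTo n f ≡ ∑< (suc n) f
sumTo≡∑< n f = sumOver-applyUpTo (suc n) (λ i → i) f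

binomialSum : ℕ → (ℕ → ℕ → ℤ) → ℤ
binomialSum m X = ∑< (suc m) (λ i → + (m C i) * X i (m ∸ i))

binomialSum-cong-diag : ∀ m {X Y : ℕ → ℕ → ℤ} →
  (∀ i → X i (m ∸ i) ≡ Y i (m ∸ i)) → binomialSum m X ≡ binomialSum m Y
binomialSum-cong-diag m X≗Y = ∑<-cong (suc m) (λ i → cong (_*_ (+ (m C i))) (X≗Y i))

binomialSum-cong : ∀ m {X Y : ℕ → ℕ → ℤ} → (∀ i r → X i r ≡ Y i r) → binomialSum m X ≡ binomialSum m Y
binomialSum-cong m {X} {Y} X≗Y = binomialSum-cong-diag m {X} {Y} (λ i → X≗Y i (m ∸ i))

binomialSum-zero : ∀ m → binomialSum m (λ _ _ → + 0) ≡ + 0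
binomialSum-zero m = trans (∑<-cong (suc m) (λ i → ℤ.*-zeroʳ (+ (m C i)))) (∑<-zero (suc m))

binomialSum-+ : ∀ m (X Y : ℕ → ℕ → ℤ) →
  binomialSum m (λ i r → X i r + Y i r) ≡ binomialSum m X + binomialSum m Y
binomialSum-+ m X Y = trans (∑<-cong (suc m) (λ i → ℤ.*-distribˡ-+ (+ (m C i)) (X i (m ∸ i)) (Y i (m ∸ i))))
  (∑<-+ (suc m) (λ i → + (m C i) * X i (m ∸ i)) (λ i → + (m C i) * Y i (m ∸ i)))

binomialSum-*ˡ : ∀ m c (X : ℕ → ℕ → ℤ) → binomialSum m (λ i r → c * X i r) ≡ c * binomialSum m X
binomialSum-*ˡ m c X = trans (∑<-cong (suc m) (λ i → *-Comm.x∙yz≈y∙xz (+ (m C i)) c (X i (m ∸ i))))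
  (∑<-*ˡ (suc m) c (λ i → + (m C i) * X i (m ∸ i)))

binomialSum-*ʳ : ∀ m c (X : ℕ → ℕ → ℤ) → binomialSum m X * c ≡ binomialSum m (λ i r → X i r * c)
binomialSum-*ʳ m c X = begin
  binomialSum m X * c                  ≡⟨ ℤ.*-comm _ c ⟩
  c * binomialSum m X                  ≡⟨ binomialSum-*ˡ m c X ⟨
  binomialSum m (λ i r → c * X i r)    ≡⟨ binomialSum-cong m (λ i r → ℤ.*-comm c (X i r)) ⟩
  binomialSum m (λ i r → X i r * c)    ∎

binomialSum-∑< : ∀ m n (X : ℕ → ℕ → ℕ → ℤ) →
  binomialSum m (λ i r → ∑< n (λ b → X b i r)) ≡ ∑< n (λ b → binomialSum m (X b))
binomialSum-∑< m n X = trans (∑<-cong (suc m) (λ i → sym (∑<-*ˡ n (+ (m C i)) (λ b → X b i (m ∸ i)))))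
  (∑<-comm (suc m) n (λ i b → + (m C i) * X b i (m ∸ i)))

binomialSum-pascal : ∀ m (X : ℕ → ℕ → ℤ) →
  binomialSum (suc m) X ≡ binomialSum m (λ i r → X (suc i) r) + binomialSum m (λ i r → X i (suc r))
binomialSum-pascal m X = begin
  + 1 * X 0 (suc m) + ∑< (suc m) (λ i → + (suc m C suc i) * X (suc i) (m ∸ i))
    ≡⟨ cong (_+_ (+ 1 * X 0 (suc m)))
         (trans (∑<-cong (suc m) split) (∑<-+ (suc m) (λ i → + (m C i) * X (suc i) (m ∸ i)) upper)) ⟩
  + 1 * X 0 (suc m) + (Left + ∑< (suc m) upper)
    ≡⟨ cong (λ t → + 1 * X 0 (suc m) + (Left + t)) upper-shift ⟩
  + 1 * X 0 (suc m) + (Left + ∑< m (λ i → + (m C suc i) * X (suc i) (suc (m ∸ suc i))))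
    ≡⟨ +-Comm.x∙yz≈y∙xz (+ 1 * X 0 (suc m)) Left _ ⟩
  Left + binomialSum m (λ i r → X i (suc r)) ∎
  where
  Left : ℤ
  Left = binomialSum m (λ i r → X (suc i) r)
  upper : ℕ → ℤ
  upper i = + (m C suc i) * X (suc i) (m ∸ i)
  split : ∀ i → + (suc m C suc i) * X (suc i) (m ∸ i) ≡ + (m C i) * X (suc i) (m ∸ i) + upper i
  split i = begin
    + (suc m C suc i) * X (suc i) (m ∸ i)
      ≡⟨ cong (λ c → + c * X (suc i) (m ∸ i)) (nCk+nC[k+1]≡[n+1]C[k+1] m i) ⟨
    (+ (m C i) + + (m C suc i)) * X (suc i) (m ∸ i)
      ≡⟨ ℤ.*-distribʳ-+ (X (suc i) (m ∸ i)) (+ (m C i)) (+ (m C suc i)) ⟩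
    + (m C i) * X (suc i) (m ∸ i) + upper i ∎
  upper-shift : ∑< (suc m) upper ≡ ∑< m (λ i → + (m C suc i) * X (suc i) (suc (m ∸ suc i)))
  upper-shift = begin
    ∑< (suc m) upper
      ≡⟨ ∑<-last m upper ⟩
    ∑< m upper + upper m
      ≡⟨ cong (λ c → ∑< m upper + + c * X (suc m) (m ∸ m)) (k>n⇒nCk≡0 (ℕ.n<1+n m)) ⟩
    ∑< m upper + + 0
      ≡⟨ ℤ.+-identityʳ _ ⟩
    ∑< m upper
      ≡⟨ ∑<-cong-< m (λ i i<m → cong (λ r → + (m C suc i) * X (suc i) r) (ℕ.+-∸-assoc 1 i<m)) ⟩
    ∑< m (λ i → + (m C suc i) * X (suc i) (suc (m ∸ suc i))) ∎

binomialSum-flip : ∀ m (X : ℕ → ℕ → ℤ) → binomialSum m X ≡ binomialSum m (flip X)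
binomialSum-flip zero    X = refl
binomialSum-flip (suc m) X = begin
  binomialSum (suc m) X
    ≡⟨ binomialSum-pascal m X ⟩
  binomialSum m (λ i r → X (suc i) r) + binomialSum m (λ i r → X i (suc r))
    ≡⟨ cong₂ _+_ (binomialSum-flip m (λ i r → X (suc i) r)) (binomialSum-flip m (λ i r → X i (suc r))) ⟩
  binomialSum m (λ i r → X (suc r) i) + binomialSum m (λ i r → X r (suc i))
    ≡⟨ ℤ.+-comm (binomialSum m (λ i r → X (suc r) i)) (binomialSum m (λ i r → X r (suc i))) ⟩
  binomialSum m (λ i r → X r (suc i)) + binomialSum m (λ i r → X (suc r) i)
    ≡⟨ binomialSum-pascal m (flip X) ⟨
  binomialSum (suc m) (flip X) ∎

binomialSum-assoc : ∀ m (V : ℕ → ℕ → ℕ → ℤ) →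
  binomialSum m (λ i r → binomialSum i (λ a t → V a t r)) ≡
  binomialSum m (λ a s → binomialSum s (λ t r → V a t r))
binomialSum-assoc zero    V = refl
binomialSum-assoc (suc m) V = begin
  binomialSum (suc m) (λ i r → binomialSum i (λ a t → V a t r))
    ≡⟨ binomialSum-pascal m (λ i r → binomialSum i (λ a t → V a t r)) ⟩
  binomialSum m (λ i r → binomialSum (suc i) (λ a t → V a t r)) + lhs (λ a t r → V a t (suc r))
    ≡⟨ cong (_+ lhs (λ a t r → V a t (suc r))) (trans
         (binomialSum-cong m (λ i r → binomialSum-pascal i (λ a t → V a t r)))
         (binomialSum-+ m (λ i r → binomialSum i (λ a t → V (suc a) t r)) (λ i r → binomialSum i (λ a t → V a (suc t) r)))) ⟩
  (lhs (λ a t r → V (suc a) t r) + lhs (λ a t r → V a (suc t) r)) + lhs (λ a t r → V a t (suc r))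
    ≡⟨ cong₂ _+_ (cong₂ _+_ (binomialSum-assoc m (λ a t r → V (suc a) t r)) (binomialSum-assoc m (λ a t r → V a (suc t) r)))
                 (binomialSum-assoc m (λ a t r → V a t (suc r))) ⟩
  (rhs (λ a t r → V (suc a) t r) + rhs (λ a t r → V a (suc t) r)) + rhs (λ a t r → V a t (suc r))
    ≡⟨ ℤ.+-assoc (rhs (λ a t r → V (suc a) t r)) (rhs (λ a t r → V a (suc t) r)) (rhs (λ a t r → V a t (suc r))) ⟩
  rhs (λ a t r → V (suc a) t r) + (rhs (λ a t r → V a (suc t) r) + rhs (λ a t r → V a t (suc r)))
    ≡⟨ cong (_+_ (rhs (λ a t r → V (suc a) t r))) (sym (trans
         (binomialSum-cong m (λ a s → binomialSum-pascal s (λ t r → V a t r)))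
         (binomialSum-+ m (λ a s → binomialSum s (λ t r → V a (suc t) r))
                          (λ a s → binomialSum s (λ t r → V a t (suc r)))))) ⟩
  rhs (λ a t r → V (suc a) t r) + binomialSum m (λ a s → binomialSum (suc s) (λ t r → V a t r))
    ≡⟨ binomialSum-pascal m (λ a s → binomialSum s (λ t r → V a t r)) ⟨
  binomialSum (suc m) (λ a s → binomialSum s (λ t r → V a t r)) ∎
  where
  lhs rhs : (ℕ → ℕ → ℕ → ℤ) → ℤ
  lhs W = binomialSum m (λ i r → binomialSum i (λ a t → W a t r))
  rhs W = binomialSum m (λ a s → binomialSum s (λ t r → W a t r))

diagonalSum : ℕ → (ℕ → ℕ → ℤ) → ℤ
diagonalSum k Y = ∑< (suc k) (λ j → Y j (k ∸ j))

diagonalSum-cong : ∀ k {Y Z : ℕ → ℕ → ℤ} → (∀ j s → Y j s ≡ Z j s) → diagonalSum k Y ≡ diagonalSum k Z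
diagonalSum-cong k Y≗Z = ∑<-cong (suc k) (λ j → Y≗Z j (k ∸ j))

diagonalSum-+ : ∀ k (Y Z : ℕ → ℕ → ℤ) →
  diagonalSum k (λ j s → Y j s + Z j s) ≡ diagonalSum k Y + diagonalSum k Z
diagonalSum-+ k Y Z = ∑<-+ (suc k) (λ j → Y j (k ∸ j)) (λ j → Z j (k ∸ j))

diagonalSum-*ˡ : ∀ k c (Y : ℕ → ℕ → ℤ) → diagonalSum k (λ j s → c * Y j s) ≡ c * diagonalSum k Y
diagonalSum-*ˡ k c Y = ∑<-*ˡ (suc k) c (λ j → Y j (k ∸ j))

binomialSum-diagonalSum : ∀ m k (X : ℕ → ℕ → ℕ → ℕ → ℤ) →
  binomialSum m (λ a t → diagonalSum k (X a t)) ≡ diagonalSum k (λ j s → binomialSum m (λ a t → X a t j s))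
binomialSum-diagonalSum m k X = binomialSum-∑< m (suc k) (λ j a t → X a t j (k ∸ j))

diagonalSum-suc : ∀ k (Y : ℕ → ℕ → ℤ) →
  diagonalSum (suc k) Y ≡ diagonalSum k (λ j s → Y j (suc s)) + Y (suc k) 0
diagonalSum-suc k Y = trans (∑<-last (suc k) (λ j → Y j (suc k ∸ j)))
  (cong₂ _+_ (∑<-cong-< (suc k) (λ j j<1+k → cong (Y j) (ℕ.+-∸-assoc 1 (ℕ.≤-pred j<1+k))))
             (cong (Y (suc k)) (ℕ.n∸n≡0 k)))

-- The first of m + 1 elements shares its block with a of the others; the remaining m − a
-- elements carry the other k blocks.
firstBlockTerm : (ℕ → ℤ) → (ℕ → ℕ → ℤ) → ℕ → ℕ → ℤ
firstBlockTerm f F m zero    = + 0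
firstBlockTerm f F m (suc k) = binomialSum m (λ a r → f (suc a) * F r k)

Recurrence : ℤ → (ℕ → ℤ) → (ℕ → ℕ → ℤ) → Set
Recurrence g f F = ∀ m k → F (suc m) k ≡ g * F m k + firstBlockTerm f F m k

InitialValues : (ℕ → ℕ → ℤ) → Set
InitialValues F = F 0 0 ≡ + 1 × (∀ k → F 0 (suc k) ≡ + 0)

recurrence-unique : ∀ {g f} {F G : ℕ → ℕ → ℤ} →
  Recurrence g f F → InitialValues F → Recurrence g f G → InitialValues G → ∀ m k → F m k ≡ G m k
recurrence-unique {g} {f} {F} {G} recF (F00 , F0s) recG (G00 , G0s) =
  <-rec (λ m → ∀ k → F m k ≡ G m k) agree
  where
  agree : ∀ m → (∀ {r} → r < m → ∀ k → F r k ≡ G r k) → ∀ k → F m k ≡ G m k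
  agree zero    _  zero    = trans F00 (sym G00)
  agree zero    _  (suc k) = trans (F0s k) (sym (G0s k))
  agree (suc m) ih k       = begin
    F (suc m) k                            ≡⟨ recF m k ⟩
    g * F m k + firstBlockTerm f F m k     ≡⟨ cong₂ _+_ (cong (_*_ g) (ih (ℕ.n<1+n m) k)) (firstBlocks k) ⟩
    g * G m k + firstBlockTerm f G m k     ≡⟨ recG m k ⟨
    G (suc m) k                            ∎
    where
    firstBlocks : ∀ k → firstBlockTerm f F m k ≡ firstBlockTerm f G m k
    firstBlocks zero    = refl
    firstBlocks (suc k) = binomialSum-cong-diag m {λ a r → f (suc a) * F r k} {λ a r → f (suc a) * G r k}
      (λ a → cong (_*_ (f (suc a))) (ih (s≤s (ℕ.m∸n≤m m a)) k))

firstBlockTerm-+ : ∀ (f₁ f₂ : ℕ → ℤ) F m k →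
  firstBlockTerm f₁ F m k + firstBlockTerm f₂ F m k ≡ firstBlockTerm (λ s → f₁ s + f₂ s) F m k
firstBlockTerm-+ f₁ f₂ F m zero    = refl
firstBlockTerm-+ f₁ f₂ F m (suc k) = begin
  binomialSum m (λ a r → f₁ (suc a) * F r k) + binomialSum m (λ a r → f₂ (suc a) * F r k)
    ≡⟨ binomialSum-+ m (λ a r → f₁ (suc a) * F r k) (λ a r → f₂ (suc a) * F r k) ⟨
  binomialSum m (λ a r → f₁ (suc a) * F r k + f₂ (suc a) * F r k)
    ≡⟨ binomialSum-cong m (λ a r → ℤ.*-distribʳ-+ (F r k) (f₁ (suc a)) (f₂ (suc a))) ⟨
  binomialSum m (λ a r → (f₁ (suc a) + f₂ (suc a)) * F r k) ∎

convolution : (ℕ → ℕ → ℤ) → (ℕ → ℕ → ℤ) → ℕ → ℕ → ℤ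
convolution F₁ F₂ m k = binomialSum m (λ i r → diagonalSum k (λ j s → F₁ i j * F₂ r s))

convolution-initialValues : ∀ {F₁ F₂} → InitialValues F₁ → InitialValues F₂ → InitialValues (convolution F₁ F₂)
convolution-initialValues {F₁} {F₂} (F₁00 , F₁0s) (F₂00 , F₂0s) =
  cong (λ x → + 1 * (x + + 0) + + 0) (cong₂ _*_ F₁00 F₂00) ,
  λ k → cong (λ x → + 1 * x + + 0) (cong₂ _+_ (cong₂ _*_ F₁00 (F₂0s k))
          (trans (∑<-cong (suc k) (λ j → cong (_* F₂ 0 (k ∸ j)) (F₁0s j))) (∑<-zero (suc k))))

module _ (F₁ F₂ : ℕ → ℕ → ℤ) where

  private
    pairing : ℕ → ℕ → ℕ → ℤ
    pairing k i r = diagonalSum k (λ j s → F₁ i j * F₂ r s)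

  convolution-firstBlockTermˡ : ∀ f m k →
    binomialSum m (λ i r → diagonalSum k (λ j s → firstBlockTerm f F₁ i j * F₂ r s)) ≡
    firstBlockTerm f (convolution F₁ F₂) m k
  convolution-firstBlockTermˡ f m zero    = binomialSum-zero m
  convolution-firstBlockTermˡ f m (suc k) = begin
    binomialSum m (λ i r → diagonalSum (suc k) (λ j s → firstBlockTerm f F₁ i j * F₂ r s))
      ≡⟨ binomialSum-cong m regroup ⟩
    binomialSum m (λ i r → binomialSum i (λ a t → f (suc a) * pairing k t r))
      ≡⟨ binomialSum-assoc m (λ a t r → f (suc a) * pairing k t r) ⟩
    binomialSum m (λ a s → binomialSum s (λ t r → f (suc a) * pairing k t r))
      ≡⟨ binomialSum-cong m (λ a s → binomialSum-*ˡ s (f (suc a)) (pairing k)) ⟩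
    binomialSum m (λ a s → f (suc a) * convolution F₁ F₂ s k) ∎
    where
    regroup : ∀ i r → diagonalSum (suc k) (λ j s → firstBlockTerm f F₁ i j * F₂ r s) ≡
                                 binomialSum i (λ a t → f (suc a) * pairing k t r)
    regroup i r = begin
      + 0 + diagonalSum k (λ j s → binomialSum i (λ a t → f (suc a) * F₁ t j) * F₂ r s)
        ≡⟨ ℤ.+-identityˡ _ ⟩
      diagonalSum k (λ j s → binomialSum i (λ a t → f (suc a) * F₁ t j) * F₂ r s)
        ≡⟨ diagonalSum-cong k (λ j s → trans (binomialSum-*ʳ i (F₂ r s) (λ a t → f (suc a) * F₁ t j))
             (binomialSum-cong i (λ a t → ℤ.*-assoc (f (suc a)) (F₁ t j) (F₂ r s)))) ⟩
      diagonalSum k (λ j s → binomialSum i (λ a t → f (suc a) * (F₁ t j * F₂ r s)))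
        ≡⟨ binomialSum-diagonalSum i k (λ a t j s → f (suc a) * (F₁ t j * F₂ r s)) ⟨
      binomialSum i (λ a t → diagonalSum k (λ j s → f (suc a) * (F₁ t j * F₂ r s)))
        ≡⟨ binomialSum-cong i (λ a t → diagonalSum-*ˡ k (f (suc a)) (λ j s → F₁ t j * F₂ r s)) ⟩
      binomialSum i (λ a t → f (suc a) * pairing k t r) ∎

  convolution-firstBlockTermʳ : ∀ f m k →
    binomialSum m (λ i r → diagonalSum k (λ j s → F₁ i j * firstBlockTerm f F₂ r s)) ≡
    firstBlockTerm f (convolution F₁ F₂) m k
  convolution-firstBlockTermʳ f m zero    =
    trans (binomialSum-cong m (λ i r → trans (ℤ.+-identityʳ _) (ℤ.*-zeroʳ (F₁ i 0)))) (binomialSum-zero m)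
  convolution-firstBlockTermʳ f m (suc k) = begin
    binomialSum m (λ i r → diagonalSum (suc k) (λ j s → F₁ i j * firstBlockTerm f F₂ r s))
      ≡⟨ binomialSum-cong m regroup ⟩
    binomialSum m (λ i r → binomialSum r (λ a t → f (suc a) * pairing k i t))
      ≡⟨ binomialSum-flip m (λ i r → binomialSum r (λ a t → f (suc a) * pairing k i t)) ⟩
    binomialSum m (λ i r → binomialSum i (λ a t → f (suc a) * pairing k r t))
      ≡⟨ binomialSum-assoc m (λ a t r → f (suc a) * pairing k r t) ⟩
    binomialSum m (λ a s → binomialSum s (λ t r → f (suc a) * pairing k r t))
      ≡⟨ binomialSum-cong m (λ a s → binomialSum-flip s (λ t r → f (suc a) * pairing k r t)) ⟩
    binomialSum m (λ a s → binomialSum s (λ t r → f (suc a) * pairing k t r))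
      ≡⟨ binomialSum-cong m (λ a s → binomialSum-*ˡ s (f (suc a)) (pairing k)) ⟩
    binomialSum m (λ a s → f (suc a) * convolution F₁ F₂ s k) ∎
    where
    regroup : ∀ i r → diagonalSum (suc k) (λ j s → F₁ i j * firstBlockTerm f F₂ r s) ≡
                                  binomialSum r (λ a t → f (suc a) * pairing k i t)
    regroup i r = begin
      diagonalSum (suc k) (λ j s → F₁ i j * firstBlockTerm f F₂ r s)
        ≡⟨ diagonalSum-suc k (λ j s → F₁ i j * firstBlockTerm f F₂ r s) ⟩
      diagonalSum k (λ j s → F₁ i j * binomialSum r (λ a t → f (suc a) * F₂ t s)) + F₁ i (suc k) * + 0
        ≡⟨ trans (cong (_+_ (diagonalSum k (λ j s → F₁ i j * binomialSum r (λ a t → f (suc a) * F₂ t s))))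
             (ℤ.*-zeroʳ (F₁ i (suc k)))) (ℤ.+-identityʳ _) ⟩
      diagonalSum k (λ j s → F₁ i j * binomialSum r (λ a t → f (suc a) * F₂ t s))
        ≡⟨ diagonalSum-cong k (λ j s → trans (sym (binomialSum-*ˡ r (F₁ i j) (λ a t → f (suc a) * F₂ t s)))
             (binomialSum-cong r (λ a t → *-Comm.x∙yz≈y∙xz (F₁ i j) (f (suc a)) (F₂ t s)))) ⟩
      diagonalSum k (λ j s → binomialSum r (λ a t → f (suc a) * (F₁ i j * F₂ t s)))
        ≡⟨ binomialSum-diagonalSum r k (λ a t j s → f (suc a) * (F₁ i j * F₂ t s)) ⟨
      binomialSum r (λ a t → diagonalSum k (λ j s → f (suc a) * (F₁ i j * F₂ t s)))
        ≡⟨ binomialSum-cong r (λ a t → diagonalSum-*ˡ k (f (suc a)) (λ j s → F₁ i j * F₂ t s)) ⟩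
      binomialSum r (λ a t → f (suc a) * pairing k i t) ∎

  convolution-recurrence : ∀ {g₁ g₂ f₁ f₂} → Recurrence g₁ f₁ F₁ → Recurrence g₂ f₂ F₂ →
    Recurrence (g₁ + g₂) (λ s → f₁ s + f₂ s) (convolution F₁ F₂)
  convolution-recurrence {g₁} {g₂} {f₁} {f₂} rec₁ rec₂ m k = begin
    convolution F₁ F₂ (suc m) k
      ≡⟨ binomialSum-pascal m (pairing k) ⟩
    binomialSum m (λ i r → pairing k (suc i) r) + binomialSum m (λ i r → pairing k i (suc r))
      ≡⟨ cong₂ _+_ (binomialSum-cong m growˡ) (binomialSum-cong m growʳ) ⟩
    binomialSum m (λ i r → g₁ * pairing k i r + Xˡ i r) + binomialSum m (λ i r → g₂ * pairing k i r + Xʳ i r)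
      ≡⟨ cong₂ _+_ (splitOff g₁ Xˡ) (splitOff g₂ Xʳ) ⟩
    (g₁ * Cₘ + binomialSum m Xˡ) + (g₂ * Cₘ + binomialSum m Xʳ)
      ≡⟨ collect g₁ g₂ Cₘ (binomialSum m Xˡ) (binomialSum m Xʳ) ⟩
    (g₁ + g₂) * Cₘ + (binomialSum m Xˡ + binomialSum m Xʳ)
      ≡⟨ cong (_+_ ((g₁ + g₂) * Cₘ))
           (cong₂ _+_ (convolution-firstBlockTermˡ f₁ m k) (convolution-firstBlockTermʳ f₂ m k)) ⟩
    (g₁ + g₂) * Cₘ + (firstBlockTerm f₁ (convolution F₁ F₂) m k + firstBlockTerm f₂ (convolution F₁ F₂) m k)
      ≡⟨ cong (_+_ ((g₁ + g₂) * Cₘ)) (firstBlockTerm-+ f₁ f₂ (convolution F₁ F₂) m k) ⟩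
    (g₁ + g₂) * Cₘ + firstBlockTerm (λ s → f₁ s + f₂ s) (convolution F₁ F₂) m k ∎
    where
    Cₘ : ℤ
    Cₘ = convolution F₁ F₂ m k
    Xˡ Xʳ : ℕ → ℕ → ℤ
    Xˡ i r = diagonalSum k (λ j s → firstBlockTerm f₁ F₁ i j * F₂ r s)
    Xʳ i r = diagonalSum k (λ j s → F₁ i j * firstBlockTerm f₂ F₂ r s)

    expandˡ : ∀ a x y z → (a * x + y) * z ≡ a * (x * z) + y * z
    expandˡ = solve-∀
    expandʳ : ∀ a x y z → x * (a * y + z) ≡ a * (x * y) + x * z
    expandʳ = solve-∀
    collect : ∀ a b x y z → (a * x + y) + (b * x + z) ≡ (a + b) * x + (y + z)
    collect = solve-∀

    growˡ : ∀ i r → pairing k (suc i) r ≡ g₁ * pairing k i r + Xˡ i r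
    growˡ i r = begin
      diagonalSum k (λ j s → F₁ (suc i) j * F₂ r s)
        ≡⟨ diagonalSum-cong k (λ j s → trans (cong (_* F₂ r s) (rec₁ i j))
             (expandˡ g₁ (F₁ i j) (firstBlockTerm f₁ F₁ i j) (F₂ r s))) ⟩
      diagonalSum k (λ j s → g₁ * (F₁ i j * F₂ r s) + firstBlockTerm f₁ F₁ i j * F₂ r s)
        ≡⟨ diagonalSum-+ k (λ j s → g₁ * (F₁ i j * F₂ r s)) (λ j s → firstBlockTerm f₁ F₁ i j * F₂ r s) ⟩
      diagonalSum k (λ j s → g₁ * (F₁ i j * F₂ r s)) + Xˡ i r
        ≡⟨ cong (_+ Xˡ i r) (diagonalSum-*ˡ k g₁ (λ j s → F₁ i j * F₂ r s)) ⟩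
      g₁ * pairing k i r + Xˡ i r ∎

    growʳ : ∀ i r → pairing k i (suc r) ≡ g₂ * pairing k i r + Xʳ i r
    growʳ i r = begin
      diagonalSum k (λ j s → F₁ i j * F₂ (suc r) s)
        ≡⟨ diagonalSum-cong k (λ j s → trans (cong (_*_ (F₁ i j)) (rec₂ r s))
             (expandʳ g₂ (F₁ i j) (F₂ r s) (firstBlockTerm f₂ F₂ r s))) ⟩
      diagonalSum k (λ j s → g₂ * (F₁ i j * F₂ r s) + F₁ i j * firstBlockTerm f₂ F₂ r s)
        ≡⟨ diagonalSum-+ k (λ j s → g₂ * (F₁ i j * F₂ r s)) (λ j s → F₁ i j * firstBlockTerm f₂ F₂ r s) ⟩
      diagonalSum k (λ j s → g₂ * (F₁ i j * F₂ r s)) + Xʳ i r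
        ≡⟨ cong (_+ Xʳ i r) (diagonalSum-*ˡ k g₂ (λ j s → F₁ i j * F₂ r s)) ⟩
      g₂ * pairing k i r + Xʳ i r ∎

    splitOff : ∀ g (X : ℕ → ℕ → ℤ) →
      binomialSum m (λ i r → g * pairing k i r + X i r) ≡ g * Cₘ + binomialSum m X
    splitOff g X = trans (binomialSum-+ m (λ i r → g * pairing k i r) X)
                         (cong (_+ binomialSum m X) (binomialSum-*ˡ m g (pairing k)))

convolution-cong : ∀ {F₁ G₁ F₂ G₂ : ℕ → ℕ → ℤ} →
  (∀ i j → F₁ i j ≡ G₁ i j) → (∀ r s → F₂ r s ≡ G₂ r s) →
  ∀ m k → convolution F₁ F₂ m k ≡ convolution G₁ G₂ m k
convolution-cong F₁≗G₁ F₂≗G₂ m k =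
  binomialSum-cong m (λ i r → diagonalSum-cong k (λ j s → cong₂ _*_ (F₁≗G₁ i j) (F₂≗G₂ r s)))

convolution-suc : ∀ (F₁ F₂ : ℕ → ℕ → ℤ) m k → convolution F₁ F₂ (suc m) k ≡
  sumTo m (λ i → sumTo k (λ j → + (m C i) *
    (F₁ (suc i) j * F₂ (m ∸ i) (k ∸ j) + F₁ i j * F₂ (suc (m ∸ i)) (k ∸ j))))
convolution-suc F₁ F₂ m k = begin
  convolution F₁ F₂ (suc m) k
    ≡⟨ binomialSum-pascal m pairing ⟩
  binomialSum m (λ i r → pairing (suc i) r) + binomialSum m (λ i r → pairing i (suc r))
    ≡⟨ binomialSum-+ m (λ i r → pairing (suc i) r) (λ i r → pairing i (suc r)) ⟨
  binomialSum m (λ i r → pairing (suc i) r + pairing i (suc r))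
    ≡⟨ binomialSum-cong m (λ i r → diagonalSum-+ k (λ j s → F₁ (suc i) j * F₂ r s) (λ j s → F₁ i j * F₂ (suc r) s)) ⟨
  ∑< (suc m) (λ i → + (m C i) * diagonalSum k (Term i (m ∸ i)))
    ≡⟨ ∑<-cong (suc m) (λ i → trans (sumTo≡∑< k (λ j → + (m C i) * Term i (m ∸ i) j (k ∸ j)))
                                    (∑<-*ˡ (suc k) (+ (m C i)) (λ j → Term i (m ∸ i) j (k ∸ j)))) ⟨
  ∑< (suc m) (λ i → sumTo k (λ j → + (m C i) * Term i (m ∸ i) j (k ∸ j)))
    ≡⟨ sumTo≡∑< m (λ i → sumTo k (λ j → + (m C i) * Term i (m ∸ i) j (k ∸ j))) ⟨
  sumTo m (λ i → sumTo k (λ j → + (m C i) * Term i (m ∸ i) j (k ∸ j))) ∎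
  where
  pairing : ℕ → ℕ → ℤ
  pairing i r = diagonalSum k (λ j s → F₁ i j * F₂ r s)
  Term : ℕ → ℕ → ℕ → ℕ → ℤ
  Term i r j s = F₁ (suc i) j * F₂ r s + F₁ i j * F₂ (suc r) s

-- The three fates of a letter `just b` when c blocks are open: it joins block b (b < c),
-- opens block c (b ≡ c), or violates the restricted-growth condition.
growth : Bool → Bool → ℤ → ℤ → ℤ
growth joins opens x y = if joins then x else if opens then y else + 0

growth-map : ∀ (φ : ℤ → ℤ) → φ (+ 0) ≡ + 0 → ∀ a b x y → φ (growth a b x y) ≡ growth a b (φ x) (φ y)
growth-map φ φ0 true  b     x y = refl
growth-map φ φ0 false true  x y = refl
growth-map φ φ0 false false x y = φ0

-- Weighted sum over the words of length r that complete a restricted-growth word with c open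
-- blocks to one with exactly j blocks; it unfolds the letters in the order `rgs` reads them.
rgsSum : ℕ → ℕ → ℕ → (List (Maybe ℕ) → ℤ) → ℤ
rgsSum j c zero    Q = if c ≡ᵇ j then Q [] else + 0
rgsSum j c (suc r) Q = rgsSum j c r (Q ∘ (nothing ∷_))
  + ∑< j (λ b → growth (b <ᵇ c) (b ≡ᵇ c) (rgsSum j c r (Q ∘ (just b ∷_))) (rgsSum j (suc c) r (Q ∘ (just b ∷_))))

rgsSum-cong : ∀ j c r {P Q : List (Maybe ℕ) → ℤ} → (∀ w → P w ≡ Q w) → rgsSum j c r P ≡ rgsSum j c r Q
rgsSum-cong j c zero    P≗Q = cong (λ x → if c ≡ᵇ j then x else + 0) (P≗Q [])
rgsSum-cong j c (suc r) P≗Q = cong₂ _+_ (rgsSum-cong j c r (P≗Q ∘ (nothing ∷_)))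
  (∑<-cong j (λ b → cong₂ (growth (b <ᵇ c) (b ≡ᵇ c)) (rgsSum-cong j c r (P≗Q ∘ (just b ∷_)))
                                                    (rgsSum-cong j (suc c) r (P≗Q ∘ (just b ∷_)))))

rgsSum-*ˡ : ∀ j c r a (Q : List (Maybe ℕ) → ℤ) → rgsSum j c r (λ w → a * Q w) ≡ a * rgsSum j c r Q
rgsSum-*ˡ j c zero    a Q = sym (growth-map (_*_ a) (ℤ.*-zeroʳ a) (c ≡ᵇ j) false (Q []) (+ 0))
rgsSum-*ˡ j c (suc r) a Q = begin
  rgsSum j c r (λ w → a * Q (nothing ∷ w)) + ∑< j (λ b → growth (b <ᵇ c) (b ≡ᵇ c)
    (rgsSum j c r (λ w → a * Q (just b ∷ w))) (rgsSum j (suc c) r (λ w → a * Q (just b ∷ w))))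
    ≡⟨ cong₂ _+_ (rgsSum-*ˡ j c r a (Q ∘ (nothing ∷_))) (∑<-cong j (λ b → trans
         (cong₂ (growth (b <ᵇ c) (b ≡ᵇ c)) (rgsSum-*ˡ j c r a (Q ∘ (just b ∷_)))
                                           (rgsSum-*ˡ j (suc c) r a (Q ∘ (just b ∷_))))
         (sym (growth-map (_*_ a) (ℤ.*-zeroʳ a) (b <ᵇ c) (b ≡ᵇ c) _ _)))) ⟩
  a * rgsSum j c r (Q ∘ (nothing ∷_)) + ∑< j (λ b → a * Next b)
    ≡⟨ cong (_+_ (a * rgsSum j c r (Q ∘ (nothing ∷_)))) (∑<-*ˡ j a Next) ⟩
  a * rgsSum j c r (Q ∘ (nothing ∷_)) + a * ∑< j Next
    ≡⟨ ℤ.*-distribˡ-+ a _ _ ⟨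
  a * rgsSum j c (suc r) Q ∎
  where
  Next : ℕ → ℤ
  Next b = growth (b <ᵇ c) (b ≡ᵇ c) (rgsSum j c r (Q ∘ (just b ∷_))) (rgsSum j (suc c) r (Q ∘ (just b ∷_)))

sumOver-growth : ∀ {A : Set} (xs : List A) a b (X Y : A → ℤ) →
  sumOver xs (λ x → growth a b (X x) (Y x)) ≡ growth a b (sumOver xs X) (sumOver xs Y)
sumOver-growth xs true  b     X Y = refl
sumOver-growth xs false true  X Y = refl
sumOver-growth xs false false X Y = sumOver-zero xs

binomialSum-growth : ∀ m a b (X Y : ℕ → ℕ → ℤ) →
  binomialSum m (λ i r → growth a b (X i r) (Y i r)) ≡ growth a b (binomialSum m X) (binomialSum m Y)
binomialSum-growth m true  b     X Y = refl
binomialSum-growth m false true  X Y = refl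
binomialSum-growth m false false X Y = binomialSum-zero m

sumOver-labels : ∀ k (h : Maybe ℕ → ℤ) → sumOver (labels k) h ≡ h nothing + ∑< k (h ∘ just)
sumOver-labels k h = cong (_+_ (h nothing)) (trans (sumOver-map (upTo k) just h) (sumOver-applyUpTo k (λ i → i) (h ∘ just)))

sumOver-words-suc : ∀ {A : Set} (L : List A) r (H : List A → ℤ) →
  sumOver (words L (suc r)) H ≡ sumOver L (λ x → sumOver (words L r) (H ∘ (x ∷_)))
sumOver-words-suc L r H = begin
  sumOver (concatMap (λ w → map (_∷ w) L) (words L r)) H
    ≡⟨ sumOver-concatMap (words L r) (λ w → map (_∷ w) L) H ⟩
  sumOver (words L r) (λ w → sumOver (map (_∷ w) L) H)
    ≡⟨ sumOver-cong (words L r) (λ w → sumOver-map L (_∷ w) H) ⟩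
  sumOver (words L r) (λ w → sumOver L (λ x → H (x ∷ w)))
    ≡⟨ sumOver-comm (words L r) L (λ w x → H (x ∷ w)) ⟩
  sumOver L (λ x → sumOver (words L r) (H ∘ (x ∷_))) ∎

restrictedWordSum≡rgsSum : ∀ j r c (Q : List (Maybe ℕ) → ℤ) →
  sumOver (words (labels j) r) (λ w → if rgs j c w then Q w else + 0) ≡ rgsSum j c r Q
restrictedWordSum≡rgsSum j zero    c Q = ℤ.+-identityʳ _
restrictedWordSum≡rgsSum j (suc r) c Q = begin
  sumOver (words (labels j) (suc r)) H
    ≡⟨ sumOver-words-suc (labels j) r H ⟩
  sumOver (labels j) (λ x → sumOver (words (labels j) r) (H ∘ (x ∷_)))
    ≡⟨ sumOver-labels j (λ x → sumOver (words (labels j) r) (H ∘ (x ∷_))) ⟩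
  sumOver (words (labels j) r) (H ∘ (nothing ∷_)) + ∑< j (λ b → sumOver (words (labels j) r) (H ∘ (just b ∷_)))
    ≡⟨ cong₂ _+_ (restrictedWordSum≡rgsSum j r c (Q ∘ (nothing ∷_))) (∑<-cong j startingWith) ⟩
  rgsSum j c (suc r) Q ∎
  where
  H : List (Maybe ℕ) → ℤ
  H w = if rgs j c w then Q w else + 0
  if-growth : ∀ a b p q x → (if (if a then p else (if b then q else false)) then x else + 0) ≡
                            growth a b (if p then x else + 0) (if q then x else + 0)
  if-growth true  b     p q x = refl
  if-growth false true  p q x = refl
  if-growth false false p q x = refl
  startingWith : ∀ b → sumOver (words (labels j) r) (H ∘ (just b ∷_)) ≡
    growth (b <ᵇ c) (b ≡ᵇ c) (rgsSum j c r (Q ∘ (just b ∷_))) (rgsSum j (suc c) r (Q ∘ (just b ∷_)))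
  startingWith b = begin
    sumOver (words (labels j) r) (H ∘ (just b ∷_))
      ≡⟨ sumOver-cong (words (labels j) r)
           (λ w → if-growth (b <ᵇ c) (b ≡ᵇ c) (rgs j c w) (rgs j (suc c) w) (Q (just b ∷ w))) ⟩
    sumOver (words (labels j) r) (λ w → growth (b <ᵇ c) (b ≡ᵇ c)
      (if rgs j c w then Q (just b ∷ w) else + 0) (if rgs j (suc c) w then Q (just b ∷ w) else + 0))
      ≡⟨ sumOver-growth (words (labels j) r) (b <ᵇ c) (b ≡ᵇ c) _ _ ⟩
    growth (b <ᵇ c) (b ≡ᵇ c)
      (sumOver (words (labels j) r) (λ w → if rgs j c w then Q (just b ∷ w) else + 0))
      (sumOver (words (labels j) r) (λ w → if rgs j (suc c) w then Q (just b ∷ w) else + 0))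
      ≡⟨ cong₂ (growth (b <ᵇ c) (b ≡ᵇ c)) (restrictedWordSum≡rgsSum j r c (Q ∘ (just b ∷_)))
                                          (restrictedWordSum≡rgsSum j r (suc c) (Q ∘ (just b ∷_))) ⟩
    growth (b <ᵇ c) (b ≡ᵇ c) (rgsSum j c r (Q ∘ (just b ∷_))) (rgsSum j (suc c) r (Q ∘ (just b ∷_))) ∎

pairSum≡rgsSum : ∀ m j (admissible : List (Maybe ℕ) → Bool) (weight : List (Maybe ℕ) → ℤ) →
  pairSum m j admissible weight ≡ rgsSum j 0 m (λ w → if admissible w then weight w else + 0)
pairSum≡rgsSum m j admissible weight = begin
  sumOver (filter (λ w → T? (admissible w)) (pairs m j)) weight
    ≡⟨ sumOver-filter admissible weight (pairs m j) ⟩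
  sumOver (filter (λ w → T? (rgs j 0 w)) (words (labels j) m)) Weight
    ≡⟨ sumOver-filter (rgs j 0) Weight (words (labels j) m) ⟩
  sumOver (words (labels j) m) (λ w → if rgs j 0 w then Weight w else + 0)
    ≡⟨ restrictedWordSum≡rgsSum j m 0 Weight ⟩
  rgsSum j 0 m Weight ∎
  where
  Weight : List (Maybe ℕ) → ℤ
  Weight w = if admissible w then weight w else + 0

dropFirstBlock : List (Maybe ℕ) → List (Maybe ℕ)
dropFirstBlock []                 = []
dropFirstBlock (nothing ∷ w)      = nothing ∷ dropFirstBlock w
dropFirstBlock (just zero ∷ w)    = dropFirstBlock w
dropFirstBlock (just (suc b) ∷ w) = just b ∷ dropFirstBlock w

count-dropFirstBlock : ∀ b w → count (isLabel b) (dropFirstBlock w) ≡ count (isLabel (suc b)) w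
count-dropFirstBlock b []                 = refl
count-dropFirstBlock b (nothing ∷ w)      = count-dropFirstBlock b w
count-dropFirstBlock b (just zero ∷ w)    = count-dropFirstBlock b w
count-dropFirstBlock b (just (suc c) ∷ w) with b ≡ᵇ c
... | true  = cong suc (count-dropFirstBlock b w)
... | false = count-dropFirstBlock b w

sizeG-dropFirstBlock : ∀ w → sizeG (dropFirstBlock w) ≡ sizeG w
sizeG-dropFirstBlock []                 = refl
sizeG-dropFirstBlock (nothing ∷ w)      = cong suc (sizeG-dropFirstBlock w)
sizeG-dropFirstBlock (just zero ∷ w)    = sizeG-dropFirstBlock w
sizeG-dropFirstBlock (just (suc c) ∷ w) = sizeG-dropFirstBlock w

blockSizes-suc : ∀ k w → blockSizes (suc k) w ≡ count (isLabel 0) w ∷ blockSizes k (dropFirstBlock w)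
blockSizes-suc k w = cong (count (isLabel 0) w ∷_) (begin
  map (λ b → count (isLabel b) w) (applyUpTo suc k)                 ≡⟨ map-applyUpTo suc (λ b → count (isLabel b) w) k ⟩
  applyUpTo (λ b → count (isLabel (suc b)) w) k                     ≡⟨ map-upTo (λ b → count (isLabel (suc b)) w) k ⟨
  map (λ b → count (isLabel (suc b)) w) (upTo k)                    ≡⟨ map-cong (λ b → count-dropFirstBlock b w) (upTo k) ⟨
  map (λ b → count (isLabel b) (dropFirstBlock w)) (upTo k)         ∎)

binomialSum-rgsSum-suc : ∀ j c m (h : ℕ → ℤ) (Q : List (Maybe ℕ) → ℤ) →
  binomialSum m (λ i r → h i * rgsSum j c (suc r) Q) ≡
  binomialSum m (λ i r → h i * rgsSum j c r (Q ∘ (nothing ∷_))) + ∑< j (λ b → growth (b <ᵇ c) (b ≡ᵇ c)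
    (binomialSum m (λ i r → h i * rgsSum j c r (Q ∘ (just b ∷_))))
    (binomialSum m (λ i r → h i * rgsSum j (suc c) r (Q ∘ (just b ∷_)))))
binomialSum-rgsSum-suc j c m h Q = begin
  binomialSum m (λ i r → h i * rgsSum j c (suc r) Q)
    ≡⟨ binomialSum-cong m (λ i r → trans (ℤ.*-distribˡ-+ (h i) _ _) (cong (_+_ (h i * rgsSum j c r (Q ∘ (nothing ∷_))))
         (trans (sym (∑<-*ˡ j (h i) (λ b → growth (b <ᵇ c) (b ≡ᵇ c) (X b r) (Y b r))))
                (∑<-cong j (λ b → growth-map (_*_ (h i)) (ℤ.*-zeroʳ (h i)) (b <ᵇ c) (b ≡ᵇ c) (X b r) (Y b r)))))) ⟩
  binomialSum m (λ i r → h i * rgsSum j c r (Q ∘ (nothing ∷_)) + ∑< j (Next i r))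
    ≡⟨ binomialSum-+ m (λ i r → h i * rgsSum j c r (Q ∘ (nothing ∷_))) (λ i r → ∑< j (Next i r)) ⟩
  binomialSum m (λ i r → h i * rgsSum j c r (Q ∘ (nothing ∷_))) + binomialSum m (λ i r → ∑< j (Next i r))
    ≡⟨ cong (_+_ (binomialSum m (λ i r → h i * rgsSum j c r (Q ∘ (nothing ∷_)))))
         (trans (binomialSum-∑< m j (λ b i r → Next i r b))
                (∑<-cong j (λ b → binomialSum-growth m (b <ᵇ c) (b ≡ᵇ c)
                                    (λ i r → h i * X b r) (λ i r → h i * Y b r)))) ⟩
  binomialSum m (λ i r → h i * rgsSum j c r (Q ∘ (nothing ∷_))) + ∑< j (λ b → growth (b <ᵇ c) (b ≡ᵇ c)
    (binomialSum m (λ i r → h i * X b r)) (binomialSum m (λ i r → h i * Y b r))) ∎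
  where
  X Y : ℕ → ℕ → ℤ
  X b r = rgsSum j c r (Q ∘ (just b ∷_))
  Y b r = rgsSum j (suc c) r (Q ∘ (just b ∷_))
  Next : ℕ → ℕ → ℕ → ℤ
  Next i r b = growth (b <ᵇ c) (b ≡ᵇ c) (h i * X b r) (h i * Y b r)

-- Choosing which i of the remaining m letters carry label 0 splits off block 0.
rgsSum-dropFirstBlock : ∀ j m c (h : ℕ → ℤ) (Q : List (Maybe ℕ) → ℤ) →
  rgsSum (suc j) (suc c) m (λ w → h (count (isLabel 0) w) * Q (dropFirstBlock w)) ≡
  binomialSum m (λ i r → h i * rgsSum j c r Q)
rgsSum-dropFirstBlock j zero    c h Q with c ≡ᵇ j
... | true  = x≡1*x+0 (h 0 * Q [])
  where
  x≡1*x+0 : ∀ x → x ≡ + 1 * x + + 0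
  x≡1*x+0 = solve-∀
... | false = cong (λ x → + 1 * x + + 0) (sym (ℤ.*-zeroʳ (h 0)))
rgsSum-dropFirstBlock j (suc m) c h Q = begin
  rgsSum (suc j) (suc c) (suc m) (λ w → h (count (isLabel 0) w) * Q (dropFirstBlock w))
    ≡⟨⟩
  rgsSum (suc j) (suc c) m (λ w → h (count (isLabel 0) w) * Q (nothing ∷ dropFirstBlock w))
    + (rgsSum (suc j) (suc c) m (λ w → h (suc (count (isLabel 0) w)) * Q (dropFirstBlock w))
       + ∑< j (λ b → growth (b <ᵇ c) (b ≡ᵇ c)
           (rgsSum (suc j) (suc c) m (λ w → h (count (isLabel 0) w) * Q (just b ∷ dropFirstBlock w)))
           (rgsSum (suc j) (suc (suc c)) m (λ w → h (count (isLabel 0) w) * Q (just b ∷ dropFirstBlock w)))))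
    ≡⟨ cong₂ _+_ (rgsSum-dropFirstBlock j m c h (Q ∘ (nothing ∷_)))
         (cong₂ _+_ (rgsSum-dropFirstBlock j m c (h ∘ suc) Q)
           (∑<-cong j (λ b → cong₂ (growth (b <ᵇ c) (b ≡ᵇ c))
              (rgsSum-dropFirstBlock j m c h (Q ∘ (just b ∷_)))
              (rgsSum-dropFirstBlock j m (suc c) h (Q ∘ (just b ∷_)))))) ⟩
  Rest + (binomialSum m (λ i r → h (suc i) * rgsSum j c r Q) + ∑< j Next)
    ≡⟨ +-Comm.x∙yz≈y∙xz Rest (binomialSum m (λ i r → h (suc i) * rgsSum j c r Q)) (∑< j Next) ⟩
  binomialSum m (λ i r → h (suc i) * rgsSum j c r Q) + (Rest + ∑< j Next)
    ≡⟨ cong (_+_ (binomialSum m (λ i r → h (suc i) * rgsSum j c r Q))) (binomialSum-rgsSum-suc j c m h Q) ⟨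
  binomialSum m (λ i r → h (suc i) * rgsSum j c r Q) + binomialSum m (λ i r → h i * rgsSum j c (suc r) Q)
    ≡⟨ binomialSum-pascal m (λ i r → h i * rgsSum j c r Q) ⟨
  binomialSum (suc m) (λ i r → h i * rgsSum j c r Q) ∎
  where
  Rest : ℤ
  Rest = binomialSum m (λ i r → h i * rgsSum j c r (Q ∘ (nothing ∷_)))
  X Y : ℕ → ℕ → ℤ
  X b r = rgsSum j c r (Q ∘ (just b ∷_))
  Y b r = rgsSum j (suc c) r (Q ∘ (just b ∷_))
  Next : ℕ → ℤ
  Next b = growth (b <ᵇ c) (b ≡ᵇ c) (binomialSum m (λ i r → h i * X b r)) (binomialSum m (λ i r → h i * Y b r))

partitionSum : ℤ → (ℕ → ℤ) → ℕ → ℕ → ℤ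
partitionSum g f m k = rgsSum k 0 m (λ w → g ^ sizeG w * blockProd k f w)

partitionSum-initialValues : ∀ g f → InitialValues (partitionSum g f)
partitionSum-initialValues g f = refl , λ k → refl

partitionSum-cong : ∀ g {f f′ : ℕ → ℤ} → (∀ s → f s ≡ f′ s) →
  ∀ m k → partitionSum g f m k ≡ partitionSum g f′ m k
partitionSum-cong g f≗f′ m k =
  rgsSum-cong k 0 m (λ w → cong (_*_ (g ^ sizeG w)) (cong prodℤ (map-cong f≗f′ (blockSizes k w))))

partitionSum-recurrence : ∀ g f → Recurrence g f (partitionSum g f)
partitionSum-recurrence g f m k = cong₂ _+_ firstElementAlone (firstElementInBlock k)
  where
  firstElementAlone : rgsSum k 0 m (λ w → (g * g ^ sizeG w) * blockProd k f w) ≡ g * partitionSum g f m k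
  firstElementAlone = trans (rgsSum-cong k 0 m (λ w → ℤ.*-assoc g (g ^ sizeG w) (blockProd k f w)))
                            (rgsSum-*ˡ k 0 m g (λ w → g ^ sizeG w * blockProd k f w))

  firstElementInBlock : ∀ k → ∑< k (λ b → growth false (b ≡ᵇ 0)
      (rgsSum k 0 m (λ w → g ^ sizeG w * blockProd k f (just b ∷ w)))
      (rgsSum k 1 m (λ w → g ^ sizeG w * blockProd k f (just b ∷ w)))) ≡
    firstBlockTerm f (partitionSum g f) m k
  firstElementInBlock zero    = refl
  firstElementInBlock (suc k) = begin
    rgsSum (suc k) 1 m (λ w → g ^ sizeG w * blockProd (suc k) f (just 0 ∷ w)) + ∑< k (λ _ → + 0)
      ≡⟨ trans (cong (_+_ (rgsSum (suc k) 1 m (λ w → g ^ sizeG w * blockProd (suc k) f (just 0 ∷ w)))) (∑<-zero k))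
               (ℤ.+-identityʳ _) ⟩
    rgsSum (suc k) 1 m (λ w → g ^ sizeG w * blockProd (suc k) f (just 0 ∷ w))
      ≡⟨ rgsSum-cong (suc k) 1 m splitFirstBlock ⟩
    rgsSum (suc k) 1 m (λ w → f (suc (count (isLabel 0) w)) * Weight (dropFirstBlock w))
      ≡⟨ rgsSum-dropFirstBlock k m 0 (f ∘ suc) Weight ⟩
    firstBlockTerm f (partitionSum g f) m (suc k) ∎
    where
    Weight : List (Maybe ℕ) → ℤ
    Weight w = g ^ sizeG w * blockProd k f w
    splitFirstBlock : ∀ w → g ^ sizeG w * blockProd (suc k) f (just 0 ∷ w) ≡
                            f (suc (count (isLabel 0) w)) * Weight (dropFirstBlock w)
    splitFirstBlock w = begin
      g ^ sizeG w * prodℤ (map f (blockSizes (suc k) (just 0 ∷ w)))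
        ≡⟨ cong (λ ss → g ^ sizeG w * prodℤ (map f ss)) (blockSizes-suc k (just 0 ∷ w)) ⟩
      g ^ sizeG w * (f (suc (count (isLabel 0) w)) * blockProd k f (dropFirstBlock w))
        ≡⟨ *-Comm.x∙yz≈y∙xz (g ^ sizeG w) (f (suc (count (isLabel 0) w))) (blockProd k f (dropFirstBlock w)) ⟩
      f (suc (count (isLabel 0) w)) * (g ^ sizeG w * blockProd k f (dropFirstBlock w))
        ≡⟨ cong (λ n → f (suc (count (isLabel 0) w)) * (g ^ n * blockProd k f (dropFirstBlock w))) (sizeG-dropFirstBlock w) ⟨
      f (suc (count (isLabel 0) w)) * Weight (dropFirstBlock w) ∎

largeBlockWeight : ℕ → ℕ → ℤ
largeBlockWeight ℓ s = if ℓ <ᵇ s then + 1 else + 0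

smallBlockWeight : ℕ → ℕ → ℕ → ℕ → ℤ
smallBlockWeight ℓ α β s = if s <ᵇ suc ℓ then degFall ((+ β) - (+ α)) (s ∸ 1) (+ α) else + 0

ℓ<ᵇs≡not[s<ᵇ1+ℓ] : ∀ ℓ s → (ℓ <ᵇ s) ≡ not (s <ᵇ suc ℓ)
ℓ<ᵇs≡not[s<ᵇ1+ℓ] ℓ       zero    = refl
ℓ<ᵇs≡not[s<ᵇ1+ℓ] zero    (suc s) = refl
ℓ<ᵇs≡not[s<ᵇ1+ℓ] (suc ℓ) (suc s) = ℓ<ᵇs≡not[s<ᵇ1+ℓ] ℓ s

wBlock-split : ∀ ℓ α β s → wBlock ℓ α β s ≡ largeBlockWeight ℓ s + smallBlockWeight ℓ α β s
wBlock-split ℓ α β s rewrite ℓ<ᵇs≡not[s<ᵇ1+ℓ] ℓ s with s <ᵇ suc ℓ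
... | true  = sym (ℤ.+-identityˡ _)
... | false = sym (ℤ.+-identityʳ _)

prodℤ-indicator : ∀ (p : ℕ → Bool) (d : ℕ → ℤ) ss →
  prodℤ (map (λ s → if p s then d s else + 0) ss) ≡ (if allB p ss then prodℤ (map d ss) else + 0)
prodℤ-indicator p d []       = refl
prodℤ-indicator p d (s ∷ ss) with p s
... | false = refl
... | true  = trans (cong (_*_ (d s)) (prodℤ-indicator p d ss))
                    (growth-map (_*_ (d s)) (ℤ.*-zeroʳ (d s)) (allB p ss) false (prodℤ (map d ss)) (+ 0))

prodℤ-ones : ∀ (ss : List ℕ) → prodℤ (map (λ _ → + 1) ss) ≡ + 1
prodℤ-ones []       = refl
prodℤ-ones (s ∷ ss) = trans (ℤ.*-identityˡ _) (prodℤ-ones ss)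

Spart≡partitionSum : ∀ γ α β ℓ m k → Spart γ α β m k ℓ ≡ partitionSum (+ γ) (wBlock ℓ α β) m k
Spart≡partitionSum γ α β ℓ m k =
  pairSum≡rgsSum m k (λ _ → true) (λ w → (+ γ) ^ sizeG w * blockProd k (wBlock ℓ α β) w)

S>ℓ≡partitionSum : ∀ ℓ γ m j → S>ℓ ℓ γ m j ≡ partitionSum (+ γ) (largeBlockWeight ℓ) m j
S>ℓ≡partitionSum ℓ γ m j = trans (pairSum≡rgsSum m j _ _) (rgsSum-cong j 0 m (λ w →
  trans (indicator-ones (allB (ℓ <ᵇ_) (blockSizes j w)) ((+ γ) ^ sizeG w) (blockSizes j w))
        (cong (_*_ ((+ γ) ^ sizeG w)) (sym (prodℤ-indicator (ℓ <ᵇ_) (λ _ → + 1) (blockSizes j w))))))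
  where
  indicator-ones : ∀ b x ss → (if b then x else + 0) ≡ x * (if b then prodℤ (map (λ _ → + 1) ss) else + 0)
  indicator-ones true  x ss = sym (trans (cong (_*_ x) (prodℤ-ones ss)) (ℤ.*-identityʳ x))
  indicator-ones false x ss = sym (ℤ.*-zeroʳ x)

S≤ℓ≡partitionSum : ∀ ℓ α β m j → S≤ℓ ℓ α β m j ≡ partitionSum (+ 0) (smallBlockWeight ℓ α β) m j
S≤ℓ≡partitionSum ℓ α β m j = trans (pairSum≡rgsSum m j _ _) (rgsSum-cong j 0 m (λ w →
  trans (zero-power (sizeG w) (allB (_<ᵇ suc ℓ) (blockSizes j w)) (blockProd j d w))
        (cong (_*_ ((+ 0) ^ sizeG w)) (sym (prodℤ-indicator (_<ᵇ suc ℓ) d (blockSizes j w))))))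
  where
  d : ℕ → ℤ
  d s = degFall ((+ β) - (+ α)) (s ∸ 1) (+ α)
  zero-power : ∀ n b x → (if (n ≡ᵇ 0) ∧ b then x else + 0) ≡ (+ 0) ^ n * (if b then x else + 0)
  zero-power zero    b x = sym (ℤ.*-identityˡ _)
  zero-power (suc n) b x = refl

Spart≡convolution : ∀ γ α β ℓ m k → Spart γ α β m k ℓ ≡ convolution (S>ℓ ℓ γ) (S≤ℓ ℓ α β) m k
Spart≡convolution γ α β ℓ m k = begin
  Spart γ α β m k ℓ
    ≡⟨ Spart≡partitionSum γ α β ℓ m k ⟩
  partitionSum (+ γ) (wBlock ℓ α β) m k
    ≡⟨ partitionSum-cong (+ γ) (wBlock-split ℓ α β) m k ⟩
  partitionSum (+ γ) f m k
    ≡⟨ cong (λ g → partitionSum g f m k) (ℤ.+-identityʳ (+ γ)) ⟨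
  partitionSum (+ γ + + 0) f m k
    ≡⟨ recurrence-unique {+ γ + + 0} {f} (partitionSum-recurrence (+ γ + + 0) f) (partitionSum-initialValues (+ γ + + 0) f)
         (convolution-recurrence F₁ F₂ {+ γ} {+ 0} {largeBlockWeight ℓ} {smallBlockWeight ℓ α β}
                                       (partitionSum-recurrence (+ γ) (largeBlockWeight ℓ))
                                       (partitionSum-recurrence (+ 0) (smallBlockWeight ℓ α β)))
         (convolution-initialValues {F₁} {F₂} (partitionSum-initialValues (+ γ) (largeBlockWeight ℓ))
                                    (partitionSum-initialValues (+ 0) (smallBlockWeight ℓ α β))) m k ⟩
  convolution F₁ F₂ m k
    ≡⟨ convolution-cong (λ i j → sym (S>ℓ≡partitionSum ℓ γ i j))
                        (λ r s → sym (S≤ℓ≡partitionSum ℓ α β r s)) m k ⟩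
  convolution (S>ℓ ℓ γ) (S≤ℓ ℓ α β) m k ∎
  where
  f : ℕ → ℤ
  f s = largeBlockWeight ℓ s + smallBlockWeight ℓ α β s
  F₁ F₂ : ℕ → ℕ → ℤ
  F₁ = partitionSum (+ γ) (largeBlockWeight ℓ)
  F₂ = partitionSum (+ 0) (smallBlockWeight ℓ α β)

-- The identity holds for all parameters.
mainTheorem6 : (n k ℓ α β γ : ℕ) → α ∣ γ → α ∣ β → k ≤ n → ℓ ≤ n →
    Spart γ α β (suc n) k ℓ ≡
      sumTo n (λ i → sumTo k (λ j →
        (+ (n C i)) *
          (S>ℓ ℓ γ (suc i) j * S≤ℓ ℓ α β (n ∸ i) (k ∸ j)
           + S>ℓ ℓ γ i j * S≤ℓ ℓ α β (suc (n ∸ i)) (k ∸ j))))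
mainTheorem6 n k ℓ α β γ _ _ _ _ =
  trans (Spart≡convolution γ α β ℓ (suc n) k) (convolution-suc (S>ℓ ℓ γ) (S≤ℓ ℓ α β) n k)
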